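{- ($\neg\neg$I) is correct at every pseudo-symmetric $\Box\Diamond^{ -1}$-model, and (Abs) is correct at every model in $\mathcal D_1$.
   Context: Formulas are built from propositional letters and $\bot$ using $\land,\lor,\to$; $\neg\alpha:=\alpha\to\bot$. For a frame $\mathfrak F=\langle W,R\rangle$, $X\subseteq W$: $\Box_{\mathfrak F}X=\{w\mid\forall v(wRv\Rightarrow v\in X)\}$, $\Diamond_{\mathfrak F}X=W\setminus\Box_{\mathfrak F}(W\setminus X)$, $\Diamond^{ -1}_{\mathfrak F}X=\{w\mid\exists x\in X,\ xRw\}$, $FP_{\mathfrak F}=\{\Box_{\mathfrak F}X\mid X\subseteq W\}$. A $\Box\Diamond^{ -1}$-model is a Kripke model with $V(p)\in FP_{\mathfrak F}$ for all $p$; truth sets: $\|p\|=V(p)$, $\|\bot\|=\Box_{\mathfrak F}\emptyset$, $\|\alpha\land\beta\|=\|\alpha\|\cap\|\beta\|$, $\|\alpha\to\beta\|=\Box_{\mathfrak F}((W\setminus\|\alpha\|)\cup\|\beta\|)$, $\|\alpha\lor\beta\|=\Box_{\mathfrak F}\Diamond^{ -1}_{\mathfrak F}(\|\alpha\|\cup\|\beta\|)$. A frame is pseudo-reflexive iff every $w\in\Box_{\mathfrak F}\emptyset\cup\Diamond_{\mathfrak F}\Box_{\mathfrak F}\Diamond^{ -1}_{\mathfrak F}\{w\}$ and pseudo-symmetric iff every $w\in\Box_{\mathfrak F}\Diamond_{\mathfrak F}\Box_{\mathfrak F}\Diamond^{ -1}_{\mathfrak F}\{w\}$; $\mathcal D_1$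 is the class of pseudo-reflexive pseudo-symmetric $\Box\Diamond^{ -1}$-models. A rule is correct at $\mathfrak M$ iff $\vDash_{\mathfrak M}$ (where $\alpha\vDash_{\mathfrak M}\beta$ iff every point satisfying $\alpha$ satisfies $\beta$) satisfies it. (Abs): $\alpha\land\neg\alpha\vdash\bot$; ($\neg\neg$I): $\alpha\vdash\neg\neg\alpha$. -}

module Defs where

open import Level using (0ℓ)
open import Data.Nat using (ℕ)
open import Data.Product using (Σ; _×_; _,_)
open import Relation.Unary using (Pred; _∈_; _∉_; _∪_; _∩_; ∁; ∅; _⊆_; _≐_)
open import Relation.Binary.PropositionalEquality using (_≡_)

record Frame : Set₁ where
  field
    W : Set
    R : W → W → Set

module Ops (F : Frame) where
  open Frame F

  □ : Pred W 0ℓ → Pred W 0ℓ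
  □ X w = ∀ v → R w v → v ∈ X

  ◇ : Pred W 0ℓ → Pred W 0ℓ
  ◇ X = ∁ (□ (∁ X))

  ◇⁻¹ : Pred W 0ℓ → Pred W 0ℓ
  ◇⁻¹ X w = Σ W λ x → x ∈ X × R x w

  ｛_｝ : W → Pred W 0ℓ
  ｛ w ｝ = λ x → x ≡ w

  InFP : Pred W 0ℓ → Set₁
  InFP Y = Σ (Pred W 0ℓ) λ X → Y ≐ □ X

PseudoReflexive : Frame → Set
PseudoReflexive F = ∀ w → w ∈ (□ ∅ ∪ ◇ (□ (◇⁻¹ ｛ w ｝)))
  where open Frame F ; open Ops F

PseudoSymmetric : Frame → Set
PseudoSymmetric F = ∀ w → w ∈ □ (◇ (□ (◇⁻¹ ｛ w ｝)))
  where open Frame F ; open Ops F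

data Form : Set where
  var  : ℕ → Form
  ⊥ᶠ   : Form
  _∧ᶠ_ : Form → Form → Form
  _∨ᶠ_ : Form → Form → Form
  _⇒ᶠ_ : Form → Form → Form

¬ᶠ_ : Form → Form
¬ᶠ α = α ⇒ᶠ ⊥ᶠ

record Model : Set₁ where
  field
    frame : Frame
  open Frame frame public
  open Ops frame public
  field
    V    : ℕ → Pred W 0ℓ
    V-FP : ∀ p → InFP (V p)

module _ (M : Model) where
  open Model M

  ∥_∥ : Form → Pred W 0ℓ
  ∥ var p ∥   = V p
  ∥ ⊥ᶠ ∥      = □ ∅
  ∥ α ∧ᶠ β ∥  = ∥ α ∥ ∩ ∥ β ∥
  ∥ α ∨ᶠ β ∥  = □ (◇⁻¹ (∥ α ∥ ∪ ∥ β ∥))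
  ∥ α ⇒ᶠ β ∥  = □ (∁ ∥ α ∥ ∪ ∥ β ∥)

  _⊨_ : Form → Form → Set
  α ⊨ β = ∥ α ∥ ⊆ ∥ β ∥

¬¬I-correct : Model → Set
¬¬I-correct M = ∀ α → _⊨_ M α (¬ᶠ (¬ᶠ α))

Abs-correct : Model → Set
Abs-correct M = ∀ α → _⊨_ M (α ∧ᶠ (¬ᶠ α)) ⊥ᶠ

In𝒟₁ : Model → Set
In𝒟₁ M = PseudoReflexive (Model.frame M) × PseudoSymmetric (Model.frame M)

{-# OPTIONS --safe #-}
-- Write w ≼ u for u ∈ □◇⁻¹{w}, i.e. every successor of u is a successor of w.
-- Every set □X, hence every truth set, is ≼-upward closed. So if w ⊨ α and
-- v ⊨ ¬α, any successor u of v with w ≼ u satisfies α ∧ ¬α and must be a dead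
-- end; in a pseudo-symmetric frame successors are never dead ends, so v has no
-- such successor. Pseudo-symmetry at w (for ¬¬I) and pseudo-reflexivity at w
-- (for Abs) demand exactly such a successor.
module Submission where

open import Defs
open import Level using (0ℓ)
open import Data.Empty using (⊥-elim)
open import Data.Product using (_×_; _,_)
open import Data.Sum using (inj₁; inj₂; [_,_]′)
open import Function using (id)
open import Relation.Binary.Definitions using (_Respects_)
open import Relation.Binary.PropositionalEquality using (refl)
open import Relation.Nullary.Negation using (contradiction)
open import Relation.Unary using (Pred; _∈_; _∉_; _∪_; ∁; ∅)
open import Axiom.ExcludedMiddle using (ExcludedMiddle)

module _ {A : Set} {P Q : Pred A 0ℓ} where

  ∪-resolveˡ : ∀ {x} → x ∈ P → x ∈ ∁ P ∪ Q → x ∈ Q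
  ∪-resolveˡ x∈P = [ contradiction x∈P , id ]′

module _ (F : Frame) where
  open Frame F
  open Ops F

  _≼_ : W → W → Set
  w ≼ u = u ∈ □ (◇⁻¹ ｛ w ｝)

  □-respects-≼ : ∀ X → □ X Respects _≼_
  □-respects-≼ X w≼u w∈□X v uRv with w≼u v uRv
  ... | _ , refl , wRv = w∈□X v wRv

  successor-∉-□∅ : PseudoSymmetric F → ∀ {v u} → R v u → u ∉ □ ∅
  successor-∉-□∅ pseudoSym {v} vRu u∈□∅ =
    pseudoSym v _ vRu (λ z uRz _ → u∈□∅ z uRz)

module _ (M : Model) where
  open Model M

  ∥∥-respects-≼ : ∀ α → ∥_∥ M α Respects _≼_ frame
  ∥∥-respects-≼ (var p) w≼u with V-FP p
  ... | X , V⊆□X , □X⊆V =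
    λ w∈V → □X⊆V (□-respects-≼ frame X w≼u (V⊆□X w∈V))
  ∥∥-respects-≼ ⊥ᶠ      = □-respects-≼ frame _
  ∥∥-respects-≼ (α ∧ᶠ β) w≼u (w⊨α , w⊨β) =
    ∥∥-respects-≼ α w≼u w⊨α , ∥∥-respects-≼ β w≼u w⊨β
  ∥∥-respects-≼ (α ∨ᶠ β) = □-respects-≼ frame _
  ∥∥-respects-≼ (α ⇒ᶠ β) = □-respects-≼ frame _

  ¬-successor-∉-∥∥ : PseudoSymmetric frame → ∀ α {v u} →
                     v ∈ ∥_∥ M (¬ᶠ α) → R v u → u ∉ ∥_∥ M α
  ¬-successor-∉-∥∥ pseudoSym α v⊨¬α vRu u⊨α =
    successor-∉-□∅ frame pseudoSym vRu
      (∪-resolveˡ {P = ∥_∥ M α} {Q = □ ∅} u⊨α (v⊨¬α _ vRu))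

  ¬-successors-not-above : PseudoSymmetric frame → ∀ α {w v} →
                           w ∈ ∥_∥ M α → v ∈ ∥_∥ M (¬ᶠ α) →
                           v ∈ □ (∁ (□ (◇⁻¹ ｛ w ｝)))
  ¬-successors-not-above pseudoSym α w⊨α v⊨¬α u vRu w≼u =
    ¬-successor-∉-∥∥ pseudoSym α v⊨¬α vRu (∥∥-respects-≼ α w≼u w⊨α)

  ¬¬I-correct-pseudoSymmetric : PseudoSymmetric frame → ¬¬I-correct M
  ¬¬I-correct-pseudoSymmetric pseudoSym α {w} w⊨α v wRv =
    inj₁ λ v⊨¬α →
      pseudoSym w v wRv (¬-successors-not-above pseudoSym α w⊨α v⊨¬α)

  Abs-correct-𝒟₁ : In𝒟₁ M → Abs-correct M
  Abs-correct-𝒟₁ (pseudoRefl , pseudoSym) α {w} (w⊨α , w⊨¬α) with pseudoRefl w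
  ... | inj₁ w∈□∅ = w∈□∅
  ... | inj₂ w∈◇□◇⁻¹w =
    ⊥-elim (w∈◇□◇⁻¹w (¬-successors-not-above pseudoSym α w⊨α w⊨¬α))

corollary1 : ExcludedMiddle 0ℓ →
    ((M : Model) → PseudoSymmetric (Model.frame M) → ¬¬I-correct M)
    × ((M : Model) → In𝒟₁ M → Abs-correct M)
corollary1 _ = ¬¬I-correct-pseudoSymmetric , Abs-correct-𝒟₁
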